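{- Let $H$ be a 3-uniform hypergraph that does not contain $C_4$ as a trace, let $A$ be the set of edges of $H$ containing at least one pair of co-degree $1$ in $H$, and let $B=H\setminus A$. Fix a vertex $v$. Then for all $u\in N_1(v)$, $|V_u|\ge d_B(u)-16$.
   Context: The co-degree $d_H(a,b)$ is the number of edges of $H$ containing $\{a,b\}$; $d_B(u)$ is the number of edges of $B$ containing $u$. $N_1(v)$ is the set of vertices $z\ne v$ lying in a common edge of $B$ with $v$; $N_2(v)$ is the set of vertices $z\notin N_1(v)\cup\{v\}$ lying in an edge of $B$ that meets $N_1(v)$. For $u\in N_1(v)$, $E_u=\{e\in B: e\cap N_1(v)=\{u\}\}$ and $V_u=\{z\in N_2(v):\exists e\in E_u,\ z\in e\}$. $H$ contains $C_4$ as a trace if there exist distinct vertices $a_1,\dots,a_4$ and four distinct edges $f_1,\dots,f_4$ of $H$ with $f_i\cap\{a_1,\dots,a_4\}=\{a_i,a_{i+1}\}$ (indices mod 4). -}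

module Defs where

open import Data.Nat using (ℕ; _≟_)
open import Data.Bool using (Bool)
import Data.Bool.Properties as BoolP
open import Data.Fin using (Fin; suc; zero)
open import Data.Fin.Subset using (Subset; _∈_; _∉_; ⁅_⁆; _∩_; _∪_; ∣_∣)
open import Data.Fin.Subset.Properties using (_∈?_)
open import Data.Fin.Properties using () renaming (_≟_ to _≟ᶠ_; any? to anyᶠ?)
open import Data.Vec using (tabulate)
import Data.Vec.Properties as VecP
open import Data.List using (List; filter; length)
open import Data.List.Relation.Unary.Any using (Any; any?)
open import Data.List.Relation.Unary.All using (All)
open import Data.List.Relation.Unary.Unique.Propositional using (Unique)
open import Data.List.Membership.Propositional using () renaming (_∈_ to _∈ₗ_)
open import Data.Product using (Σ; _×_; _,_; ∃)
open import Relation.Nullary using (Dec; ¬_; does; _×-dec_; ¬?)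
open import Relation.Binary.PropositionalEquality using (_≡_; _≢_)

_≟ˢ_ : ∀ {n} → (p q : Subset n) → Dec (p ≡ q)
_≟ˢ_ = VecP.≡-dec BoolP._≟_

record Hypergraph3 (n : ℕ) : Set where
  field
    edges    : List (Subset n)
    uniform3 : All (λ e → ∣ e ∣ ≡ 3) edges
    distinct : Unique edges
open Hypergraph3 public

deg : ∀ {n} → List (Subset n) → Fin n → ℕ
deg E u = length (filter (λ e → u ∈? e) E)

codeg : ∀ {n} → List (Subset n) → Fin n → Fin n → ℕ
codeg E a b = length (filter (λ e → (a ∈? e) ×-dec (b ∈? e)) E)

ContainsC4Trace : ∀ {n} → Hypergraph3 n → Set
ContainsC4Trace {n} H =
  Σ (Fin n) λ a₁ → Σ (Fin n) λ a₂ → Σ (Fin n) λ a₃ → Σ (Fin n) λ a₄ →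
  Σ (Subset n) λ f₁ → Σ (Subset n) λ f₂ → Σ (Subset n) λ f₃ → Σ (Subset n) λ f₄ →
    (a₁ ≢ a₂ × a₁ ≢ a₃ × a₁ ≢ a₄ × a₂ ≢ a₃ × a₂ ≢ a₄ × a₃ ≢ a₄)
  × (f₁ ∈ₗ edges H × f₂ ∈ₗ edges H × f₃ ∈ₗ edges H × f₄ ∈ₗ edges H)
  × (f₁ ≢ f₂ × f₁ ≢ f₃ × f₁ ≢ f₄ × f₂ ≢ f₃ × f₂ ≢ f₄ × f₃ ≢ f₄)
  × (let S = ⁅ a₁ ⁆ ∪ (⁅ a₂ ⁆ ∪ (⁅ a₃ ⁆ ∪ ⁅ a₄ ⁆)) in
       (f₁ ∩ S ≡ ⁅ a₁ ⁆ ∪ ⁅ a₂ ⁆)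
     × (f₂ ∩ S ≡ ⁅ a₂ ⁆ ∪ ⁅ a₃ ⁆)
     × (f₃ ∩ S ≡ ⁅ a₃ ⁆ ∪ ⁅ a₄ ⁆)
     × (f₄ ∩ S ≡ ⁅ a₄ ⁆ ∪ ⁅ a₁ ⁆))

HasCodeg1Pair : ∀ {n} → Hypergraph3 n → Subset n → Set
HasCodeg1Pair {n} H e =
  ∃ λ (a : Fin n) → ∃ λ (b : Fin n) →
    ¬ (a ≡ b) × a ∈ e × b ∈ e × codeg (edges H) a b ≡ 1

hasCodeg1Pair? : ∀ {n} (H : Hypergraph3 n) (e : Subset n) → Dec (HasCodeg1Pair H e)
hasCodeg1Pair? H e =
  anyᶠ? λ a → anyᶠ? λ b →
    ¬? (a ≟ᶠ b) ×-dec (a ∈? e) ×-dec (b ∈? e) ×-dec (codeg (edges H) a b ≟ 1)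

Aedges : ∀ {n} → Hypergraph3 n → List (Subset n)
Aedges H = filter (hasCodeg1Pair? H) (edges H)

Bedges : ∀ {n} → Hypergraph3 n → List (Subset n)
Bedges H = filter (λ e → ¬? (hasCodeg1Pair? H e)) (edges H)

module _ {n : ℕ} (H : Hypergraph3 n) (v : Fin n) where

  private B = Bedges H

  InN₁ : Fin n → Set
  InN₁ z = ¬ (z ≡ v) × Any (λ e → v ∈ e × z ∈ e) B

  inN₁? : ∀ z → Dec (InN₁ z)
  inN₁? z = ¬? (z ≟ᶠ v) ×-dec any? (λ e → (v ∈? e) ×-dec (z ∈? e)) B

  N₁ : Subset n
  N₁ = tabulate (λ z → does (inN₁? z))

  InN₂ : Fin n → Set
  InN₂ z = z ∉ N₁ × ¬ (z ≡ v)
         × Any (λ e → z ∈ e × ∃ λ w → w ∈ N₁ × w ∈ e) B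

  inN₂? : ∀ z → Dec (InN₂ z)
  inN₂? z = ¬? (z ∈? N₁) ×-dec ¬? (z ≟ᶠ v)
          ×-dec any? (λ e → (z ∈? e) ×-dec anyᶠ? (λ w → (w ∈? N₁) ×-dec (w ∈? e))) B

  N₂ : Subset n
  N₂ = tabulate (λ z → does (inN₂? z))

  E : Fin n → List (Subset n)
  E u = filter (λ e → (e ∩ N₁) ≟ˢ ⁅ u ⁆) B

  InV : Fin n → Fin n → Set
  InV u z = z ∈ N₂ × Any (λ e → z ∈ e) (E u)

  inV? : ∀ u z → Dec (InV u z)
  inV? u z = (z ∈? N₂) ×-dec any? (λ e → z ∈? e) (E u)

  V : Fin n → Subset n
  V u = tabulate (λ z → does (inV? u z))

-- Split the B-edges at u into E_u and the rest. An edge of E_u meets N₁(v) only in u, so its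
-- two other vertices lie in V_u; every other B-edge at u contains a second vertex w ∈ N₁(v).
-- Everything then rests on one fact: in a C₄-trace-free H, a pair of vertices lies in at most
-- two edges of B. Indeed, both remaining pairs of a B-edge {p,q,y} lie in further edges of H
-- (no pair of a B-edge has co-degree 1); for two apexes y₁, y₂ these further edges either
-- close a 4-cycle y₁ q y₂ p or form an edge {y₁,y₂,q} or {y₁,y₂,p}, and among three apexes two
-- such edges through the same vertex close a 4-cycle around it. Double counting then gives |E_u| ≤ |V_u| and bounds the remaining edges by twice
-- the number of such vertices w. Of these at most two span a B-edge with u and v; each other
-- w comes with edges {u,w,z} (z ≠ v) and {v,w,r} (r ≠ u), and two such w form a 4-cycle
-- u w v w′ unless one of their four tips z, r hits the other. Six such w would need 15 hits
-- from 12 tips, so there are at most 7 vertices w and at most 14 remaining edges.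

module Submission where

open import Algebra.Properties.CommutativeSemigroup using (interchange)
open import Data.Bool using (true; false; if_then_else_)
open import Data.Empty using (⊥; ⊥-elim)
open import Data.Fin using (Fin; zero; suc; #_; combine; inject≤)
open import Data.Fin.Properties
  using (pigeonhole; combine-injective; inject≤-injective; <⇒≢; suc-injective; ¬∀⟶∃¬)
  renaming (_≟_ to _≟ᶠ_; any? to anyᶠ?; all? to allᶠ?)
open import Data.Fin.Subset using (Subset; _∈_; _∉_; ⁅_⁆; _∩_; _∪_; _⊆_; _-_; ∣_∣)
open import Data.Fin.Subset.Properties
  using ( _∈?_; ⊆-antisym; p⊆q⇒∣p∣≤∣q∣; ∣⁅x⁆∣≡1; x∈p∧x≢y⇒x∈p-y; x∈p⇒∣p-x∣<∣p∣
        ; x∈p∩q⁺; x∈p∩q⁻; x∈p∪q⁺; x∈p∪q⁻; x∈⁅x⁆; x∈⁅y⁆⇒x≡y)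
open import Data.List using (List; []; _∷_; map; length; filter; lookup)
open import Data.List.Properties using (length-map)
open import Data.List.Membership.Propositional using (lose; find) renaming (_∈_ to _∈ₗ_)
open import Data.List.Membership.Propositional.Properties using (∈-filter⁺; ∈-filter⁻; ∈-lookup)
open import Data.List.Relation.Unary.All as All using (All; []; _∷_)
import Data.List.Relation.Unary.All.Properties as All
open import Data.List.Relation.Unary.Any using (Any; here; there; any?)
open import Data.List.Relation.Unary.AllPairs using ([]; _∷_)
open import Data.List.Relation.Unary.Unique.Propositional using (Unique)
import Data.List.Relation.Unary.Unique.Propositional.Properties as Unique
open import Data.Nat using (ℕ; zero; suc; _+_; _*_; _∸_; _≤_; z≤n; s≤s; _≤?_)
open import Data.Nat.ListAction using (sum)
open import Data.Nat.Properties
  using ( ≤-trans; ≤-reflexive; <-irrefl; ≰⇒>; n≤1+n; m≤m+n; +-suc; *-suc; *-zeroʳ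
        ; +-comm; +-mono-≤; +-monoˡ-≤; +-monoʳ-≤; *-monoʳ-≤; *-identityˡ; *-cancelˡ-≤; m≤n+o⇒m∸n≤o
        ; +-commutativeSemigroup; module ≤-Reasoning)
open import Data.Product using (∃; ∃₂; _×_; _,_; proj₁; proj₂; swap)
open import Data.Product.Properties using (≡-dec)
open import Data.Sum using (_⊎_; inj₁; inj₂)
open import Data.Vec using (Vec; []; _∷_; tabulate; _[_]=_)
import Data.Vec as Vec
open import Data.Vec.Properties using (lookup∘tabulate; []=⇒lookup; lookup⇒[]=)
open import Function using (_∘_)
open import Relation.Binary.PropositionalEquality
  using (_≡_; _≢_; refl; sym; trans; cong; cong₂; subst; ≢-sym; module ≡-Reasoning)
open import Relation.Nullary using (¬_; Dec; yes; no; does; ¬?; _×-dec_; contradiction)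
open import Relation.Nullary.Decidable using (dec-true; toWitness; _⊎-dec_; _→-dec_)
open import Relation.Unary.Properties using (∁?)

open import Defs

module _ {n} {P : Fin n → Set} (P? : ∀ z → Dec (P z)) where

  ∈-tabulate⁺ : ∀ {z} → P z → z ∈ tabulate (does ∘ P?)
  ∈-tabulate⁺ {z} pz =
    lookup⇒[]= z _ (trans (lookup∘tabulate (does ∘ P?) z) (dec-true (P? z) pz))

  ∈-tabulate⁻ : ∀ {z} → z ∈ tabulate (does ∘ P?) → P z
  ∈-tabulate⁻ {z} z∈ = witness (P? z) (trans (sym (lookup∘tabulate (does ∘ P?) z)) ([]=⇒lookup z∈))
    where
    witness : ∀ {A : Set} (a? : Dec A) → does a? ≡ true → A
    witness (yes a) _  = a
    witness (no _)  ()

Unique⇒length≤∣∣ : ∀ {n} {p : Subset n} {xs : List (Fin n)} →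
                   Unique xs → All (_∈ p) xs → length xs ≤ ∣ p ∣
Unique⇒length≤∣∣ [] [] = z≤n
Unique⇒length≤∣∣ {p = p} (x∉xs ∷ xs!) (x∈p ∷ xs⊆p) =
  ≤-trans (s≤s (Unique⇒length≤∣∣ xs! (All.zipWith ∈p-x (x∉xs , xs⊆p)))) (x∈p⇒∣p-x∣<∣p∣ x∈p)
  where
  ∈p-x : ∀ {x y} → x ≢ y × y ∈ p → y ∈ p - x
  ∈p-x (x≢y , y∈p) = x∈p∧x≢y⇒x∈p-y y∈p (≢-sym x≢y)

members : ∀ {n} → Subset n → List (Fin n)
members []          = []
members (true ∷ p)  = zero ∷ map suc (members p)
members (false ∷ p) = map suc (members p)

length-members : ∀ {n} (p : Subset n) → length (members p) ≡ ∣ p ∣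
length-members []          = refl
length-members (true ∷ p)  = cong suc (trans (length-map suc (members p)) (length-members p))
length-members (false ∷ p) = trans (length-map suc (members p)) (length-members p)

members-unique : ∀ {n} (p : Subset n) → Unique (members p)
members-unique []          = []
members-unique (true ∷ p)  =
  All.map⁺ (All.universal (λ _ ()) (members p)) ∷ Unique.map⁺ suc-injective (members-unique p)
members-unique (false ∷ p) = Unique.map⁺ suc-injective (members-unique p)

members-⊆ : ∀ {n} (p : Subset n) → All (_∈ p) (members p)
members-⊆ []          = []
members-⊆ (true ∷ p)  = _[_]=_.here ∷ All.map⁺ (All.map _[_]=_.there (members-⊆ p))
members-⊆ (false ∷ p) = All.map⁺ (All.map _[_]=_.there (members-⊆ p))

∣p∪q∣≤∣p∣+∣q∣ : ∀ {n} (p q : Subset n) → ∣ p ∪ q ∣ ≤ ∣ p ∣ + ∣ q ∣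
∣p∪q∣≤∣p∣+∣q∣ []          []          = z≤n
∣p∪q∣≤∣p∣+∣q∣ (true ∷ p)  (true ∷ q)  =
  s≤s (≤-trans (∣p∪q∣≤∣p∣+∣q∣ p q) (+-monoʳ-≤ ∣ p ∣ (n≤1+n ∣ q ∣)))
∣p∪q∣≤∣p∣+∣q∣ (true ∷ p)  (false ∷ q) = s≤s (∣p∪q∣≤∣p∣+∣q∣ p q)
∣p∪q∣≤∣p∣+∣q∣ (false ∷ p) (true ∷ q)  =
  ≤-trans (s≤s (∣p∪q∣≤∣p∣+∣q∣ p q)) (≤-reflexive (sym (+-suc ∣ p ∣ ∣ q ∣)))
∣p∪q∣≤∣p∣+∣q∣ (false ∷ p) (false ∷ q) = ∣p∪q∣≤∣p∣+∣q∣ p q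

∃∉pair : ∀ {n} {e : Subset n} → 3 ≤ ∣ e ∣ → ∀ a b → ∃ λ c → c ∈ e × c ≢ a × c ≢ b
∃∉pair {e = e} 3≤∣e∣ a b
  with anyᶠ? (λ c → (c ∈? e) ×-dec ¬? (c ≟ᶠ a) ×-dec ¬? (c ≟ᶠ b))
... | yes found = found
... | no none   = contradiction (≤-trans 3≤∣e∣ ∣e∣≤2) (<-irrefl refl)
  where
  open ≤-Reasoning
  e⊆ab : e ⊆ ⁅ a ⁆ ∪ ⁅ b ⁆
  e⊆ab {z} z∈e with z ≟ᶠ a | z ≟ᶠ b
  ... | yes refl | _        = x∈p∪q⁺ (inj₁ (x∈⁅x⁆ z))
  ... | no _     | yes refl = x∈p∪q⁺ (inj₂ (x∈⁅x⁆ z))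
  ... | no z≢a   | no z≢b   = ⊥-elim (none (z , z∈e , z≢a , z≢b))
  ∣e∣≤2 : ∣ e ∣ ≤ 2
  ∣e∣≤2 = begin
    ∣ e ∣                   ≤⟨ p⊆q⇒∣p∣≤∣q∣ e⊆ab ⟩
    ∣ ⁅ a ⁆ ∪ ⁅ b ⁆ ∣       ≤⟨ ∣p∪q∣≤∣p∣+∣q∣ ⁅ a ⁆ ⁅ b ⁆ ⟩
    ∣ ⁅ a ⁆ ∣ + ∣ ⁅ b ⁆ ∣   ≡⟨ cong₂ _+_ (∣⁅x⁆∣≡1 a) (∣⁅x⁆∣≡1 b) ⟩
    2                       ∎

record Triple {n} (e : Subset n) (a b c : Fin n) : Set where
  field
    a∈  : a ∈ e
    b∈  : b ∈ e
    c∈  : c ∈ e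
    a≢b : a ≢ b
    a≢c : a ≢ c
    b≢c : b ≢ c
    ⊆abc : ∀ {z} → z ∈ e → z ≡ a ⊎ z ≡ b ⊎ z ≡ c
open Triple

module _ {n} {e : Subset n} where

  mkTriple : ∀ {a b c} → ∣ e ∣ ≡ 3 → a ∈ e → b ∈ e → c ∈ e →
             a ≢ b → a ≢ c → b ≢ c → Triple e a b c
  mkTriple {a} {b} {c} ∣e∣≡3 a∈e b∈e c∈e a≢b a≢c b≢c = record
    { a∈ = a∈e ; b∈ = b∈e ; c∈ = c∈e ; a≢b = a≢b ; a≢c = a≢c ; b≢c = b≢c ; ⊆abc = e⊆abc }
    where
    e⊆abc : ∀ {z} → z ∈ e → z ≡ a ⊎ z ≡ b ⊎ z ≡ c
    e⊆abc {z} z∈e with z ≟ᶠ a | z ≟ᶠ b | z ≟ᶠ c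
    ... | yes z≡a | _       | _       = inj₁ z≡a
    ... | no _    | yes z≡b | _       = inj₂ (inj₁ z≡b)
    ... | no _    | no _    | yes z≡c = inj₂ (inj₂ z≡c)
    ... | no z≢a  | no z≢b  | no z≢c  = contradiction (subst (4 ≤_) ∣e∣≡3 4≤∣e∣) (<-irrefl refl)
      where
      4≤∣e∣ : 4 ≤ ∣ e ∣
      4≤∣e∣ = Unique⇒length≤∣∣
        ((z≢a ∷ z≢b ∷ z≢c ∷ []) ∷ (a≢b ∷ a≢c ∷ []) ∷ (b≢c ∷ []) ∷ [] ∷ [])
        (z∈e ∷ a∈e ∷ b∈e ∷ c∈e ∷ [])

  complete-triple : ∀ {a b} → ∣ e ∣ ≡ 3 → a ∈ e → b ∈ e → a ≢ b → ∃ λ c → Triple e a b c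
  complete-triple {a} {b} ∣e∣≡3 a∈e b∈e a≢b with ∃∉pair (≤-reflexive (sym ∣e∣≡3)) a b
  ... | c , c∈e , c≢a , c≢b = c , mkTriple ∣e∣≡3 a∈e b∈e c∈e a≢b (≢-sym c≢a) (≢-sym c≢b)

  triple-through : ∀ {a} → ∣ e ∣ ≡ 3 → a ∈ e → ∃₂ λ b c → Triple e a b c
  triple-through {a} ∣e∣≡3 a∈e with ∃∉pair (≤-reflexive (sym ∣e∣≡3)) a a
  ... | b , b∈e , b≢a , _ = b , complete-triple ∣e∣≡3 a∈e b∈e (≢-sym b≢a)

  ∉-triple : ∀ {a b c z} → Triple e a b c → z ≢ a → z ≢ b → z ≢ c → z ∉ e
  ∉-triple t z≢a z≢b z≢c z∈e with ⊆abc t z∈e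
  ... | inj₁ z≡a        = z≢a z≡a
  ... | inj₂ (inj₁ z≡b) = z≢b z≡b
  ... | inj₂ (inj₂ z≡c) = z≢c z≡c

  Triple-swap₁₂ : ∀ {a b c} → Triple e a b c → Triple e b a c
  Triple-swap₁₂ t = record
    { a∈ = b∈ t ; b∈ = a∈ t ; c∈ = c∈ t ; a≢b = ≢-sym (a≢b t) ; a≢c = b≢c t ; b≢c = a≢c t
    ; ⊆abc = λ z∈e → swap₁₂ (⊆abc t z∈e) }
    where
    swap₁₂ : ∀ {A B C : Set} → A ⊎ B ⊎ C → B ⊎ A ⊎ C
    swap₁₂ (inj₁ x)        = inj₂ (inj₁ x)
    swap₁₂ (inj₂ (inj₁ x)) = inj₁ x
    swap₁₂ (inj₂ (inj₂ x)) = inj₂ (inj₂ x)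

  Triple-swap₂₃ : ∀ {a b c} → Triple e a b c → Triple e a c b
  Triple-swap₂₃ t = record
    { a∈ = a∈ t ; b∈ = c∈ t ; c∈ = b∈ t ; a≢b = a≢c t ; a≢c = a≢b t ; b≢c = ≢-sym (b≢c t)
    ; ⊆abc = λ z∈e → swap₂₃ (⊆abc t z∈e) }
    where
    swap₂₃ : ∀ {A B C : Set} → A ⊎ B ⊎ C → A ⊎ C ⊎ B
    swap₂₃ (inj₁ x)        = inj₁ x
    swap₂₃ (inj₂ (inj₁ x)) = inj₂ (inj₂ x)
    swap₂₃ (inj₂ (inj₂ x)) = inj₂ (inj₁ x)

triple-unique : ∀ {n} {e f : Subset n} {a b c} → Triple e a b c → Triple f a b c → e ≡ f
triple-unique t s = ⊆-antisym (⊆ t s) (⊆ s t)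
  where
  ⊆ : ∀ {e f a b c} → Triple e a b c → Triple f a b c → e ⊆ f
  ⊆ t s z∈e with ⊆abc t z∈e
  ... | inj₁ refl        = a∈ s
  ... | inj₂ (inj₁ refl) = b∈ s
  ... | inj₂ (inj₂ refl) = c∈ s

quad : ∀ {n} → Fin n → Fin n → Fin n → Fin n → Subset n
quad a₁ a₂ a₃ a₄ = ⁅ a₁ ⁆ ∪ (⁅ a₂ ⁆ ∪ (⁅ a₃ ⁆ ∪ ⁅ a₄ ⁆))

module _ {n} {a₁ a₂ a₃ a₄ : Fin n} where

  ∈quad⁻ : ∀ {z} → z ∈ quad a₁ a₂ a₃ a₄ → z ≡ a₁ ⊎ z ≡ a₂ ⊎ z ≡ a₃ ⊎ z ≡ a₄
  ∈quad⁻ z∈ with x∈p∪q⁻ ⁅ a₁ ⁆ _ z∈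
  ... | inj₁ z∈₁ = inj₁ (x∈⁅y⁆⇒x≡y a₁ z∈₁)
  ... | inj₂ z∈₂₃₄ with x∈p∪q⁻ ⁅ a₂ ⁆ _ z∈₂₃₄
  ... | inj₁ z∈₂ = inj₂ (inj₁ (x∈⁅y⁆⇒x≡y a₂ z∈₂))
  ... | inj₂ z∈₃₄ with x∈p∪q⁻ ⁅ a₃ ⁆ _ z∈₃₄
  ... | inj₁ z∈₃ = inj₂ (inj₂ (inj₁ (x∈⁅y⁆⇒x≡y a₃ z∈₃)))
  ... | inj₂ z∈₄ = inj₂ (inj₂ (inj₂ (x∈⁅y⁆⇒x≡y a₄ z∈₄)))

  a₁∈quad : a₁ ∈ quad a₁ a₂ a₃ a₄
  a₁∈quad = x∈p∪q⁺ (inj₁ (x∈⁅x⁆ a₁))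

  a₂∈quad : a₂ ∈ quad a₁ a₂ a₃ a₄
  a₂∈quad = x∈p∪q⁺ (inj₂ (x∈p∪q⁺ (inj₁ (x∈⁅x⁆ a₂))))

  a₃∈quad : a₃ ∈ quad a₁ a₂ a₃ a₄
  a₃∈quad = x∈p∪q⁺ (inj₂ (x∈p∪q⁺ (inj₂ (x∈p∪q⁺ (inj₁ (x∈⁅x⁆ a₃))))))

  a₄∈quad : a₄ ∈ quad a₁ a₂ a₃ a₄
  a₄∈quad = x∈p∪q⁺ (inj₂ (x∈p∪q⁺ (inj₂ (x∈p∪q⁺ (inj₂ (x∈⁅x⁆ a₄))))))

rotate : ∀ {A B C D : Set} → A ⊎ B ⊎ C ⊎ D → B ⊎ C ⊎ D ⊎ A
rotate (inj₁ a)               = inj₂ (inj₂ (inj₂ a))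
rotate (inj₂ (inj₁ b))        = inj₁ b
rotate (inj₂ (inj₂ (inj₁ c))) = inj₂ (inj₁ c)
rotate (inj₂ (inj₂ (inj₂ d))) = inj₂ (inj₂ (inj₁ d))

∩≡pair : ∀ {n} {f S : Subset n} {x y x' y'} →
         (∀ {z} → z ∈ S → z ≡ x ⊎ z ≡ y ⊎ z ≡ x' ⊎ z ≡ y') → x ∈ S → y ∈ S →
         x ∈ f → y ∈ f → x' ∉ f → y' ∉ f → f ∩ S ≡ ⁅ x ⁆ ∪ ⁅ y ⁆
∩≡pair {f = f} {S} {x} {y} S⊆xyx'y' x∈S y∈S x∈f y∈f x'∉f y'∉f = ⊆-antisym ⊆pair pair⊆
  where
  ⊆pair : f ∩ S ⊆ ⁅ x ⁆ ∪ ⁅ y ⁆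
  ⊆pair z∈f∩S with x∈p∩q⁻ f S z∈f∩S
  ... | z∈f , z∈S with S⊆xyx'y' z∈S
  ... | inj₁ refl               = x∈p∪q⁺ (inj₁ (x∈⁅x⁆ x))
  ... | inj₂ (inj₁ refl)        = x∈p∪q⁺ (inj₂ (x∈⁅x⁆ y))
  ... | inj₂ (inj₂ (inj₁ refl)) = ⊥-elim (x'∉f z∈f)
  ... | inj₂ (inj₂ (inj₂ refl)) = ⊥-elim (y'∉f z∈f)
  pair⊆ : ⁅ x ⁆ ∪ ⁅ y ⁆ ⊆ f ∩ S
  pair⊆ z∈xy with x∈p∪q⁻ ⁅ x ⁆ ⁅ y ⁆ z∈xy
  ... | inj₁ z∈x rewrite x∈⁅y⁆⇒x≡y x z∈x = x∈p∩q⁺ (x∈f , x∈S)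
  ... | inj₂ z∈y rewrite x∈⁅y⁆⇒x≡y y z∈y = x∈p∩q⁺ (y∈f , y∈S)

separate : ∀ {n} {f g : Subset n} {x} → x ∈ f → x ∉ g → f ≢ g
separate x∈f x∉g refl = x∉g x∈f

module _ {A : Set} where

  unique-other : ∀ {x} {xs : List A} → Unique xs → x ∈ₗ xs → length xs ≢ 1 →
                 ∃ λ y → y ∈ₗ xs × y ≢ x
  unique-other {xs = _ ∷ []}    _               _           ≢1 = ⊥-elim (≢1 refl)
  unique-other {xs = _ ∷ z ∷ _} ((y≢z ∷ _) ∷ _) (here refl) _  = z , there (here refl) , ≢-sym y≢z
  unique-other {xs = y ∷ _ ∷ _} (y∉ ∷ _)        (there x∈)  _  = y , here refl , All.lookup y∉ x∈

  lookup-injective : ∀ {xs : List A} → Unique xs → ∀ i j → lookup xs i ≡ lookup xs j → i ≡ j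
  lookup-injective {_ ∷ _} _         zero    zero    _  = refl
  lookup-injective {_ ∷ _} (x∉ ∷ _)  zero    (suc j) eq = ⊥-elim (All.lookup x∉ (∈-lookup j) eq)
  lookup-injective {_ ∷ _} (x∉ ∷ _)  (suc i) zero    eq =
    ⊥-elim (All.lookup x∉ (∈-lookup i) (sym eq))
  lookup-injective {_ ∷ _} (_ ∷ xs!) (suc i) (suc j) eq = cong suc (lookup-injective xs! i j eq)

module _ {A : Set} {P : A → Set} (P? : ∀ x → Dec (P x)) where

  length-filter-partition : ∀ xs → length xs ≡ length (filter P? xs) + length (filter (∁? P?) xs)
  length-filter-partition []       = refl
  length-filter-partition (x ∷ xs) with P? x
  ... | yes _ = cong suc (length-filter-partition xs)
  ... | no _  = trans (cong suc (length-filter-partition xs))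
                      (sym (+-suc (length (filter P? xs)) (length (filter (∁? P?) xs))))

  length-filter-filter : ∀ {Q : A → Set} (Q? : ∀ x → Dec (Q x)) xs →
                         length (filter P? (filter Q? xs)) ≤ length (filter P? xs)
  length-filter-filter Q? []       = z≤n
  length-filter-filter Q? (x ∷ xs) with does (Q? x)
  ... | true with does (P? x)
  ...   | true  = s≤s (length-filter-filter Q? xs)
  ...   | false = length-filter-filter Q? xs
  length-filter-filter Q? (x ∷ xs) | false with does (P? x)
  ...   | true  = ≤-trans (length-filter-filter Q? xs) (n≤1+n _)
  ...   | false = length-filter-filter Q? xs

-- Double counting vertex–edge incidences

sumOver : ∀ {n} → Subset n → (Fin n → ℕ) → ℕ
sumOver []          f = 0
sumOver (true ∷ p)  f = f zero + sumOver p (f ∘ suc)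
sumOver (false ∷ p) f = sumOver p (f ∘ suc)

sumOver-cong : ∀ {n} (p : Subset n) {f g : Fin n → ℕ} → (∀ z → f z ≡ g z) →
               sumOver p f ≡ sumOver p g
sumOver-cong []          f≗g = refl
sumOver-cong (true ∷ p)  f≗g = cong₂ _+_ (f≗g zero) (sumOver-cong p (f≗g ∘ suc))
sumOver-cong (false ∷ p) f≗g = sumOver-cong p (f≗g ∘ suc)

sumOver-zero : ∀ {n} (p : Subset n) → sumOver p (λ _ → 0) ≡ 0
sumOver-zero []          = refl
sumOver-zero (true ∷ p)  = sumOver-zero p
sumOver-zero (false ∷ p) = sumOver-zero p

sumOver-+ : ∀ {n} (p : Subset n) (f g : Fin n → ℕ) →
            sumOver p (λ z → f z + g z) ≡ sumOver p f + sumOver p g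
sumOver-+ []          f g = refl
sumOver-+ (true ∷ p)  f g = trans (cong (f zero + g zero +_) (sumOver-+ p (f ∘ suc) (g ∘ suc)))
                                  (interchange +-commutativeSemigroup (f zero) (g zero) _ _)
sumOver-+ (false ∷ p) f g = sumOver-+ p (f ∘ suc) (g ∘ suc)

sumOver-≤ : ∀ {n} (p : Subset n) {f : Fin n → ℕ} {d} → (∀ {z} → z ∈ p → f z ≤ d) →
            sumOver p f ≤ d * ∣ p ∣
sumOver-≤ []          f≤d = z≤n
sumOver-≤ (true ∷ p)  {d = d} f≤d = begin
  _             ≤⟨ +-mono-≤ (f≤d _[_]=_.here) (sumOver-≤ p (f≤d ∘ _[_]=_.there)) ⟩
  d + d * ∣ p ∣ ≡⟨ sym (*-suc d ∣ p ∣) ⟩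
  d * suc ∣ p ∣ ∎
  where open ≤-Reasoning
sumOver-≤ (false ∷ p) f≤d = sumOver-≤ p (f≤d ∘ _[_]=_.there)

indicator : ∀ {n} → Subset n → Fin n → ℕ
indicator e z = if does (z ∈? e) then 1 else 0

sumOver-indicator : ∀ {n} (p e : Subset n) → sumOver p (indicator e) ≡ ∣ p ∩ e ∣
sumOver-indicator []          []          = refl
sumOver-indicator (true ∷ p)  (true ∷ e)  = cong suc (sumOver-indicator p e)
sumOver-indicator (true ∷ p)  (false ∷ e) = sumOver-indicator p e
sumOver-indicator (false ∷ p) (true ∷ e)  = sumOver-indicator p e
sumOver-indicator (false ∷ p) (false ∷ e) = sumOver-indicator p e

deg-∷ : ∀ {n} (e : Subset n) (L : List (Subset n)) z → deg (e ∷ L) z ≡ indicator e z + deg L z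
deg-∷ e L z with z ∈? e
... | yes _ = refl
... | no _  = refl

sumOver-deg : ∀ {n} (p : Subset n) (L : List (Subset n)) →
              sumOver p (deg L) ≡ sum (map (λ e → ∣ p ∩ e ∣) L)
sumOver-deg p []      = sumOver-zero p
sumOver-deg p (e ∷ L) = begin
  sumOver p (deg (e ∷ L))                           ≡⟨ sumOver-cong p (deg-∷ e L) ⟩
  sumOver p (λ z → indicator e z + deg L z)         ≡⟨ sumOver-+ p (indicator e) (deg L) ⟩
  sumOver p (indicator e) + sumOver p (deg L)
    ≡⟨ cong₂ _+_ (sumOver-indicator p e) (sumOver-deg p L) ⟩
  ∣ p ∩ e ∣ + sum (map (λ e → ∣ p ∩ e ∣) L)         ∎
  where open ≡-Reasoning

*-length≤sum : ∀ {A : Set} {f : A → ℕ} {c} {xs : List A} → All (λ x → c ≤ f x) xs →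
               c * length xs ≤ sum (map f xs)
*-length≤sum {c = c} []                        = ≤-reflexive (*-zeroʳ c)
*-length≤sum {c = c} {_ ∷ xs} (c≤fx ∷ c≤fxs) =
  ≤-trans (≤-reflexive (*-suc c (length xs))) (+-mono-≤ c≤fx (*-length≤sum c≤fxs))

double-count : ∀ {n} (p : Subset n) (L : List (Subset n)) {c d} →
               All (λ e → c ≤ ∣ p ∩ e ∣) L → (∀ {z} → z ∈ p → deg L z ≤ d) →
               c * length L ≤ d * ∣ p ∣
double-count p L {c} {d} c≤∣p∩e∣ deg≤d = begin
  c * length L                     ≤⟨ *-length≤sum c≤∣p∩e∣ ⟩
  sum (map (λ e → ∣ p ∩ e ∣) L)    ≡⟨ sym (sumOver-deg p L) ⟩
  sumOver p (deg L)                ≤⟨ sumOver-≤ p deg≤d ⟩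
  d * ∣ p ∣                        ∎
  where open ≤-Reasoning

-- Pointers between six points

pairs : Vec (Fin 6 × Fin 6) 15
pairs = (# 0 , # 1) ∷ (# 0 , # 2) ∷ (# 0 , # 3) ∷ (# 0 , # 4) ∷ (# 0 , # 5) ∷
        (# 1 , # 2) ∷ (# 1 , # 3) ∷ (# 1 , # 4) ∷ (# 1 , # 5) ∷
        (# 2 , # 3) ∷ (# 2 , # 4) ∷ (# 2 , # 5) ∷
        (# 3 , # 4) ∷ (# 3 , # 5) ∷ (# 4 , # 5) ∷ []

pair : Fin 15 → Fin 6 × Fin 6
pair = Vec.lookup pairs

SamePair : Fin 6 × Fin 6 → Fin 6 × Fin 6 → Set
SamePair p q = p ≡ q ⊎ p ≡ swap q

samePair? : ∀ p q → Dec (SamePair p q)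
samePair? p q = ≡-dec _≟ᶠ_ _≟ᶠ_ p q ⊎-dec ≡-dec _≟ᶠ_ _≟ᶠ_ p (swap q)

SamePair-via : ∀ {p q r} → SamePair p r → SamePair q r → SamePair p q
SamePair-via (inj₁ refl) (inj₁ refl) = inj₁ refl
SamePair-via (inj₁ refl) (inj₂ refl) = inj₂ refl
SamePair-via (inj₂ refl) (inj₁ refl) = inj₂ refl
SamePair-via (inj₂ refl) (inj₂ refl) = inj₁ refl

pair-injective : ∀ k l → SamePair (pair k) (pair l) → k ≡ l
pair-injective =
  toWitness {a? = allᶠ? λ k → allᶠ? λ l → samePair? (pair k) (pair l) →-dec (k ≟ᶠ l)} _

pair-distinct : ∀ k → proj₁ (pair k) ≢ proj₂ (pair k)
pair-distinct = toWitness {a? = allᶠ? λ k → ¬? (proj₁ (pair k) ≟ᶠ proj₂ (pair k))} _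

module _ {n} (W : Fin 6 → Fin n) (W-injective : ∀ {i j} → W i ≡ W j → i ≡ j)
         (pointer : Fin 6 → Fin 2 → Fin n) where

  Hits : Fin 6 → Fin 6 → Set
  Hits i j = ∃ λ t → pointer i t ≡ W j

  Joined : Fin 15 → Set
  Joined k = Hits (proj₁ (pair k)) (proj₂ (pair k)) ⊎ Hits (proj₂ (pair k)) (proj₁ (pair k))

  joined? : ∀ k → Dec (Joined k)
  joined? k = hits? _ _ ⊎-dec hits? _ _
    where
    hits? : ∀ i j → Dec (Hits i j)
    hits? i j = anyᶠ? λ t → pointer i t ≟ᶠ W j

  record Joining (k : Fin 15) : Set where
    field
      source target : Fin 6
      slot          : Fin 2
      hits          : pointer source slot ≡ W target
      covers        : SamePair (pair k) (source , target)
  open Joining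

  joining : ∀ k → Joined k → Joining k
  joining k (inj₁ (t , hit)) = record { slot = t ; hits = hit ; covers = inj₁ refl }
  joining k (inj₂ (t , hit)) = record { slot = t ; hits = hit ; covers = inj₂ refl }

  -- Twelve pointers cannot join fifteen pairs.
  ¬all-joined : (∀ k → Joined k) → ⊥
  ¬all-joined joined
    with pigeonhole (m≤m+n 13 2) (λ k → combine (source (J k)) (slot (J k)))
    where J = λ k → joining k (joined k)
  ... | k , l , k<l , same = <⇒≢ k<l (pair-injective k l (SamePair-via (covers Jk) covers′))
    where
    Jk = joining k (joined k)
    Jl = joining l (joined l)
    same-pointer = combine-injective (source Jk) (slot Jk) (source Jl) (slot Jl) same
    same-target : target Jk ≡ target Jl
    same-target = W-injective (trans (sym (hits Jk))
      (trans (cong₂ pointer (proj₁ same-pointer) (proj₂ same-pointer)) (hits Jl)))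
    covers′ : SamePair (pair l) (source Jk , target Jk)
    covers′ rewrite proj₁ same-pointer | same-target = covers Jl

  unjoined-pair : ∃₂ λ i j → i ≢ j × (∀ t → pointer i t ≢ W j) × (∀ t → pointer j t ≢ W i)
  unjoined-pair with allᶠ? joined?
  ... | yes all-joined = ⊥-elim (¬all-joined all-joined)
  ... | no ¬all with ¬∀⟶∃¬ 15 Joined joined? ¬all
  ...   | k , ¬joined = proj₁ (pair k) , proj₂ (pair k) , pair-distinct k ,
            (λ t hit → ¬joined (inj₁ (t , hit))) , (λ t hit → ¬joined (inj₂ (t , hit)))

-- Hypergraphs without a trace of C₄

module C4Free {n : ℕ} (H : Hypergraph3 n) (noC4 : ¬ ContainsC4Trace H) where

  B : List (Subset n)
  B = Bedges H

  B⊆H : ∀ {e} → e ∈ₗ B → e ∈ₗ edges H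
  B⊆H = proj₁ ∘ ∈-filter⁻ (λ e → ¬? (hasCodeg1Pair? H e)) {xs = edges H}

  B-codegree≢1 : ∀ {e} → e ∈ₗ B → ¬ HasCodeg1Pair H e
  B-codegree≢1 = proj₂ ∘ ∈-filter⁻ (λ e → ¬? (hasCodeg1Pair? H e)) {xs = edges H}

  B-unique : Unique B
  B-unique = Unique.filter⁺ _ (distinct H)

  ∣edge∣≡3 : ∀ {e} → e ∈ₗ edges H → ∣ e ∣ ≡ 3
  ∣edge∣≡3 = All.lookup (uniform3 H)

  record EdgeOn (x y z : Fin n) : Set where
    constructor edgeOn
    field
      {edge} : Subset n
      ∈H     : edge ∈ₗ edges H
      triple : Triple edge x y z
  open EdgeOn

  EdgeOn-swap₁₂ : ∀ {x y z} → EdgeOn x y z → EdgeOn y x z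
  EdgeOn-swap₁₂ (edgeOn f∈H t) = edgeOn f∈H (Triple-swap₁₂ t)

  EdgeOn-swap₂₃ : ∀ {x y z} → EdgeOn x y z → EdgeOn x z y
  EdgeOn-swap₂₃ (edgeOn f∈H t) = edgeOn f∈H (Triple-swap₂₃ t)

  record CycleEdge (x y x' y' : Fin n) : Set where
    constructor cycleEdge
    field
      {apex}  : Fin n
      on      : EdgeOn x y apex
      apex≢x' : apex ≢ x'
      apex≢y' : apex ≢ y'

  ¬cycle : ∀ {a₁ a₂ a₃ a₄} → a₁ ≢ a₃ → a₂ ≢ a₄ →
           CycleEdge a₁ a₂ a₃ a₄ → CycleEdge a₂ a₃ a₄ a₁ →
           CycleEdge a₃ a₄ a₁ a₂ → CycleEdge a₄ a₁ a₂ a₃ → ⊥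
  ¬cycle {a₁} {a₂} {a₃} {a₄} a₁≢a₃ a₂≢a₄
         (cycleEdge (edgeOn {f₁} f₁∈H t₁) w₁≢a₃ w₁≢a₄)
         (cycleEdge (edgeOn {f₂} f₂∈H t₂) w₂≢a₄ w₂≢a₁)
         (cycleEdge (edgeOn {f₃} f₃∈H t₃) w₃≢a₁ w₃≢a₂)
         (cycleEdge (edgeOn {f₄} f₄∈H t₄) w₄≢a₂ w₄≢a₃) =
    noC4 ( a₁ , a₂ , a₃ , a₄ , f₁ , f₂ , f₃ , f₄
         , (a₁≢a₂ , a₁≢a₃ , ≢-sym a₄≢a₁ , a₂≢a₃ , a₂≢a₄ , a₃≢a₄)
         , (f₁∈H , f₂∈H , f₃∈H , f₄∈H)
         , ( separate (a∈ t₁) a₁∉f₂ , separate (a∈ t₁) a₁∉f₃ , separate (b∈ t₁) a₂∉f₄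
           , separate (a∈ t₂) a₂∉f₃ , separate (a∈ t₂) a₂∉f₄ , separate (a∈ t₃) a₃∉f₄ )
         , ∩≡pair ∈quad⁻ a₁∈quad a₂∈quad (a∈ t₁) (b∈ t₁) a₃∉f₁ a₄∉f₁
         , ∩≡pair (rotate ∘ ∈quad⁻) a₂∈quad a₃∈quad (a∈ t₂) (b∈ t₂) a₄∉f₂ a₁∉f₂
         , ∩≡pair (rotate ∘ rotate ∘ ∈quad⁻) a₃∈quad a₄∈quad (a∈ t₃) (b∈ t₃) a₁∉f₃ a₂∉f₃
         , ∩≡pair (rotate ∘ rotate ∘ rotate ∘ ∈quad⁻) a₄∈quad a₁∈quad (a∈ t₄) (b∈ t₄) a₂∉f₄ a₃∉f₄ )
    where
    a₁≢a₂ = a≢b t₁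
    a₂≢a₃ = a≢b t₂
    a₃≢a₄ = a≢b t₃
    a₄≢a₁ = a≢b t₄
    a₃∉f₁ = ∉-triple t₁ (≢-sym a₁≢a₃) (≢-sym a₂≢a₃) (≢-sym w₁≢a₃)
    a₄∉f₁ = ∉-triple t₁ a₄≢a₁ (≢-sym a₂≢a₄) (≢-sym w₁≢a₄)
    a₄∉f₂ = ∉-triple t₂ (≢-sym a₂≢a₄) (≢-sym a₃≢a₄) (≢-sym w₂≢a₄)
    a₁∉f₂ = ∉-triple t₂ a₁≢a₂ a₁≢a₃ (≢-sym w₂≢a₁)
    a₁∉f₃ = ∉-triple t₃ a₁≢a₃ (≢-sym a₄≢a₁) (≢-sym w₃≢a₁)
    a₂∉f₃ = ∉-triple t₃ a₂≢a₃ a₂≢a₄ (≢-sym w₃≢a₂)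
    a₂∉f₄ = ∉-triple t₄ a₂≢a₄ (≢-sym a₁≢a₂) (≢-sym w₄≢a₂)
    a₃∉f₄ = ∉-triple t₄ a₃≢a₄ (≢-sym a₁≢a₃) (≢-sym w₄≢a₃)

  ¬wheel : ∀ {b a₁ a₂ a₃ a₄} → a₁ ≢ a₃ → a₂ ≢ a₄ →
           EdgeOn b a₁ a₂ → EdgeOn b a₂ a₃ → EdgeOn b a₃ a₄ → EdgeOn b a₄ a₁ → ⊥
  ¬wheel a₁≢a₃ a₂≢a₄ e₁ e₂ e₃ e₄ =
    ¬cycle a₁≢a₃ a₂≢a₄ (spoke e₁ (a≢c (triple e₂)) (a≢c (triple e₃)))
                       (spoke e₂ (a≢c (triple e₃)) (a≢c (triple e₄)))
                       (spoke e₃ (a≢c (triple e₄)) (a≢c (triple e₁)))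
                       (spoke e₄ (a≢c (triple e₁)) (a≢c (triple e₂)))
    where
    spoke : ∀ {b x y x' y'} → EdgeOn b x y → b ≢ x' → b ≢ y' → CycleEdge x y x' y'
    spoke e = cycleEdge (EdgeOn-swap₂₃ (EdgeOn-swap₁₂ e))

  another-edge : ∀ {e a b} → e ∈ₗ B → a ≢ b → a ∈ e → b ∈ e →
                 ∃ λ h → h ∈ₗ edges H × h ≢ e × a ∈ h × b ∈ h
  another-edge {e} {a} {b} e∈B a≢b a∈e b∈e
    with unique-other (Unique.filter⁺ ab? (distinct H))
                      (∈-filter⁺ ab? (B⊆H e∈B) (a∈e , b∈e))
                      (λ codeg≡1 → B-codegree≢1 e∈B (a , b , a≢b , a∈e , b∈e , codeg≡1))
    where ab? = λ e → (a ∈? e) ×-dec (b ∈? e)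
  ... | h , h∈ , h≢e with ∈-filter⁻ (λ e → (a ∈? e) ×-dec (b ∈? e)) {xs = edges H} h∈
  ...   | h∈H , a∈h , b∈h = h , h∈H , h≢e , a∈h , b∈h

  Wing : Fin n → Fin n → Fin n → Set
  Wing x y z = ∃ λ s → EdgeOn x y s × s ≢ z

  wing : ∀ {e x y z} → e ∈ₗ B → Triple e x y z → Wing x y z
  wing e∈B t with another-edge e∈B (a≢b t) (a∈ t) (b∈ t)
  ... | h , h∈H , h≢e , x∈h , y∈h with complete-triple (∣edge∣≡3 h∈H) x∈h y∈h (a≢b t)
  ...   | s , t′ = s , edgeOn h∈H t′ , λ { refl → h≢e (triple-unique t′ t) }

  apexes-joined : ∀ {p q y₁ y₂ e₁ e₂} → e₁ ∈ₗ B → e₂ ∈ₗ B →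
                  Triple e₁ p q y₁ → Triple e₂ p q y₂ → y₁ ≢ y₂ →
                  EdgeOn q y₁ y₂ ⊎ EdgeOn p y₁ y₂
  apexes-joined {y₁ = y₁} {y₂} e₁∈B e₂∈B t₁ t₂ y₁≢y₂
    with wing e₁∈B (y-q-p t₁) | wing e₂∈B (y-q-p t₂) | wing e₁∈B (y-p-q t₁) | wing e₂∈B (y-p-q t₂)
    where
    y-q-p : ∀ {e p q y} → Triple e p q y → Triple e y q p
    y-q-p = Triple-swap₁₂ ∘ Triple-swap₂₃ ∘ Triple-swap₁₂
    y-p-q : ∀ {e p q y} → Triple e p q y → Triple e y p q
    y-p-q = Triple-swap₁₂ ∘ Triple-swap₂₃
  ... | s₁ , h₁ , s₁≢p | s₂ , h₂ , s₂≢p | r₁ , g₁ , r₁≢q | r₂ , g₂ , r₂≢q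
    with s₁ ≟ᶠ y₂ | s₂ ≟ᶠ y₁ | r₁ ≟ᶠ y₂ | r₂ ≟ᶠ y₁
  ... | yes refl | _        | _        | _        = inj₁ (EdgeOn-swap₁₂ h₁)
  ... | no _     | yes refl | _        | _        = inj₁ (EdgeOn-swap₂₃ (EdgeOn-swap₁₂ h₂))
  ... | no _     | no _     | yes refl | _        = inj₂ (EdgeOn-swap₁₂ g₁)
  ... | no _     | no _     | no _     | yes refl = inj₂ (EdgeOn-swap₂₃ (EdgeOn-swap₁₂ g₂))
  ... | no s₁≢y₂ | no s₂≢y₁ | no r₁≢y₂ | no r₂≢y₁ = ⊥-elim (¬cycle y₁≢y₂ (≢-sym (a≢b t₁))
        (cycleEdge h₁ s₁≢y₂ s₁≢p)
        (cycleEdge (EdgeOn-swap₁₂ h₂) s₂≢p s₂≢y₁)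
        (cycleEdge g₂ r₂≢y₁ r₂≢q)
        (cycleEdge (EdgeOn-swap₁₂ g₁) r₁≢q r₁≢y₂))

  -- Two of the three apex pairs are joined through the same vertex of {p, q}.
  ¬three-B-triples : ∀ {p q y₁ y₂ y₃ e₁ e₂ e₃} → e₁ ∈ₗ B → e₂ ∈ₗ B → e₃ ∈ₗ B →
                     Triple e₁ p q y₁ → Triple e₂ p q y₂ → Triple e₃ p q y₃ →
                     y₁ ≢ y₂ → y₁ ≢ y₃ → y₂ ≢ y₃ → ⊥
  ¬three-B-triples e₁∈B e₂∈B e₃∈B t₁ t₂ t₃ y₁≢y₂ y₁≢y₃ y₂≢y₃ =
    cases (apexes-joined e₁∈B e₂∈B t₁ t₂ y₁≢y₂) (apexes-joined e₁∈B e₃∈B t₁ t₃ y₁≢y₃)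
          (apexes-joined e₂∈B e₃∈B t₂ t₃ y₂≢y₃)
    where
    wheel : ∀ {c c′ yᵢ yⱼ yₖ} → EdgeOn c c′ yⱼ → EdgeOn c c′ yₖ → EdgeOn c yᵢ yⱼ → EdgeOn c yᵢ yₖ →
            c′ ≢ yᵢ → yⱼ ≢ yₖ → ⊥
    wheel cc′j cc′k cij cik c′≢yᵢ yⱼ≢yₖ =
      ¬wheel c′≢yᵢ yⱼ≢yₖ cc′j (EdgeOn-swap₂₃ cij) cik (EdgeOn-swap₂₃ cc′k)
    Q₁ = edgeOn (B⊆H e₁∈B) (Triple-swap₁₂ t₁)
    Q₂ = edgeOn (B⊆H e₂∈B) (Triple-swap₁₂ t₂)
    Q₃ = edgeOn (B⊆H e₃∈B) (Triple-swap₁₂ t₃)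
    P₁ = edgeOn (B⊆H e₁∈B) t₁
    P₂ = edgeOn (B⊆H e₂∈B) t₂
    P₃ = edgeOn (B⊆H e₃∈B) t₃
    cases : _ → _ → _ → ⊥
    cases (inj₁ q₁₂) (inj₁ q₁₃) _          = wheel Q₂ Q₃ q₁₂ q₁₃ (a≢c t₁) y₂≢y₃
    cases (inj₁ q₁₂) (inj₂ _)   (inj₁ q₂₃) = wheel Q₁ Q₃ (EdgeOn-swap₂₃ q₁₂) q₂₃ (a≢c t₂) y₁≢y₃
    cases (inj₁ _)   (inj₂ p₁₃) (inj₂ p₂₃) =
      wheel P₁ P₂ (EdgeOn-swap₂₃ p₁₃) (EdgeOn-swap₂₃ p₂₃) (b≢c t₃) y₁≢y₂
    cases (inj₂ _)   (inj₁ q₁₃) (inj₁ q₂₃) =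
      wheel Q₁ Q₂ (EdgeOn-swap₂₃ q₁₃) (EdgeOn-swap₂₃ q₂₃) (a≢c t₃) y₁≢y₂
    cases (inj₂ p₁₂) (inj₁ _)   (inj₂ p₂₃) = wheel P₁ P₃ (EdgeOn-swap₂₃ p₁₂) p₂₃ (b≢c t₂) y₁≢y₃
    cases (inj₂ p₁₂) (inj₂ p₁₃) _          = wheel P₂ P₃ p₁₂ p₁₃ (b≢c t₁) y₂≢y₃

  apart : ∀ {e e′ : Subset n} {p q y y′} → Triple e p q y → Triple e′ p q y′ → e ≢ e′ → y ≢ y′
  apart t t′ e≢e′ refl = e≢e′ (triple-unique t t′)

  B-codegree≤2 : ∀ {p q} {L : List (Subset n)} → p ≢ q → Unique L →
                 All (λ e → e ∈ₗ B × p ∈ e × q ∈ e) L → length L ≤ 2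
  B-codegree≤2 _ []           _ = z≤n
  B-codegree≤2 _ (_ ∷ [])     _ = s≤s z≤n
  B-codegree≤2 _ (_ ∷ _ ∷ []) _ = s≤s (s≤s z≤n)
  B-codegree≤2 {p} {q} p≢q ((e₁≢e₂ ∷ e₁≢e₃ ∷ _) ∷ (e₂≢e₃ ∷ _) ∷ _) (E₁ ∷ E₂ ∷ E₃ ∷ _) = ⊥-elim (
    ¬three-B-triples (proj₁ E₁) (proj₁ E₂) (proj₁ E₃) t₁ t₂ t₃
                     (apart t₁ t₂ e₁≢e₂) (apart t₁ t₃ e₁≢e₃) (apart t₂ t₃ e₂≢e₃))
    where
    apex : ∀ {e} → e ∈ₗ B × p ∈ e × q ∈ e → ∃ (Triple e p q)
    apex (e∈B , p∈e , q∈e) = complete-triple (∣edge∣≡3 (B⊆H e∈B)) p∈e q∈e p≢q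
    t₁ = proj₂ (apex E₁)
    t₂ = proj₂ (apex E₂)
    t₃ = proj₂ (apex E₃)

  B-common-neighbours≤2 : ∀ {p q} {ws : List (Fin n)} → Unique ws →
                          All (λ w → ∃ λ e → e ∈ₗ B × Triple e p q w) ws → length ws ≤ 2
  B-common-neighbours≤2 []           _ = z≤n
  B-common-neighbours≤2 (_ ∷ [])     _ = s≤s z≤n
  B-common-neighbours≤2 (_ ∷ _ ∷ []) _ = s≤s (s≤s z≤n)
  B-common-neighbours≤2 ((w₁≢w₂ ∷ w₁≢w₃ ∷ _) ∷ (w₂≢w₃ ∷ _) ∷ _)
                        ((_ , e₁∈B , t₁) ∷ (_ , e₂∈B , t₂) ∷ (_ , e₃∈B , t₃) ∷ _) =
    ⊥-elim (¬three-B-triples e₁∈B e₂∈B e₃∈B t₁ t₂ t₃ w₁≢w₂ w₁≢w₃ w₂≢w₃)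

  Bridge : Fin n → Fin n → Fin n → Set
  Bridge u v w = Wing u w v × Wing v w u

  uTip vTip : ∀ {u v w} → Bridge u v w → Fin n
  uTip = proj₁ ∘ proj₁
  vTip = proj₁ ∘ proj₂

  ¬crossing : ∀ {u v w₁ w₂} → u ≢ v → w₁ ≢ w₂ → (b₁ : Bridge u v w₁) (b₂ : Bridge u v w₂) →
              uTip b₁ ≢ w₂ → vTip b₁ ≢ w₂ → uTip b₂ ≢ w₁ → vTip b₂ ≢ w₁ → ⊥
  ¬crossing u≢v w₁≢w₂ ((_ , U₁ , z₁≢v) , (_ , V₁ , r₁≢u)) ((_ , U₂ , z₂≢v) , (_ , V₂ , r₂≢u))
            z₁≢w₂ r₁≢w₂ z₂≢w₁ r₂≢w₁ =
    ¬cycle u≢v w₁≢w₂ (cycleEdge U₁ z₁≢v z₁≢w₂) (cycleEdge (EdgeOn-swap₁₂ V₁) r₁≢w₂ r₁≢u)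
                     (cycleEdge V₂ r₂≢u r₂≢w₁) (cycleEdge (EdgeOn-swap₁₂ U₂) z₂≢w₁ z₂≢v)

  ¬six-bridges : ∀ {u v} {ws : List (Fin n)} → u ≢ v → Unique ws → All (Bridge u v) ws →
                 6 ≤ length ws → ⊥
  ¬six-bridges {u} {v} {ws} u≢v ws! bridges 6≤∣ws∣ = crossing (unjoined-pair W W-injective pointer)
    where
    W : Fin 6 → Fin n
    W i = lookup ws (inject≤ i 6≤∣ws∣)
    W-injective : ∀ {i j} → W i ≡ W j → i ≡ j
    W-injective {i} {j} = inject≤-injective 6≤∣ws∣ 6≤∣ws∣ i j ∘ lookup-injective ws! _ _
    bridge : ∀ i → Bridge u v (W i)
    bridge i = All.lookup bridges (∈-lookup (inject≤ i 6≤∣ws∣))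
    pointer : Fin 6 → Fin 2 → Fin n
    pointer i zero    = uTip (bridge i)
    pointer i (suc _) = vTip (bridge i)
    crossing : (∃₂ λ i j → i ≢ j × (∀ t → pointer i t ≢ W j) × (∀ t → pointer j t ≢ W i)) → ⊥
    crossing (i , j , i≢j , i↛j , j↛i) =
      ¬crossing u≢v (i≢j ∘ W-injective) (bridge i) (bridge j)
                (i↛j zero) (i↛j (suc zero)) (j↛i zero) (j↛i (suc zero))

  bridges≤5 : ∀ {u v} {ws : List (Fin n)} → u ≢ v → Unique ws → All (Bridge u v) ws →
              length ws ≤ 5
  bridges≤5 {ws = ws} u≢v ws! bridges with length ws ≤? 5
  ... | yes ∣ws∣≤5 = ∣ws∣≤5
  ... | no ∣ws∣≰5  = ⊥-elim (¬six-bridges u≢v ws! bridges (≰⇒> ∣ws∣≰5))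

-- The neighbourhood of v

module Neighbourhood {n} (H : Hypergraph3 n) (noC4 : ¬ ContainsC4Trace H)
                     (v u : Fin n) (u∈N₁ : u ∈ N₁ H v) where
  open C4Free H noC4
  open ≤-Reasoning

  N₁⇒≢v : ∀ {w} → w ∈ N₁ H v → w ≢ v
  N₁⇒≢v = proj₁ ∘ ∈-tabulate⁻ (inN₁? H v)

  u≢v : u ≢ v
  u≢v = N₁⇒≢v u∈N₁

  OnlyU : Subset n → Set
  OnlyU e = e ∩ N₁ H v ≡ ⁅ u ⁆

  onlyU? : ∀ e → Dec (OnlyU e)
  onlyU? e = (e ∩ N₁ H v) ≟ˢ ⁅ u ⁆

  E-edge : ∀ {e} → e ∈ₗ E H v u → e ∈ₗ B × OnlyU e
  E-edge = ∈-filter⁻ onlyU? {xs = B}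

  OnlyU⇒u∈ : ∀ {e} → OnlyU e → u ∈ e
  OnlyU⇒u∈ {e} e∩N₁≡u = proj₁ (x∈p∩q⁻ e (N₁ H v) (subst (u ∈_) (sym e∩N₁≡u) (x∈⁅x⁆ u)))

  OnlyU⇒≡u : ∀ {e z} → OnlyU e → z ∈ e → z ∈ N₁ H v → z ≡ u
  OnlyU⇒≡u e∩N₁≡u z∈e z∈N₁ = x∈⁅y⁆⇒x≡y u (subst (_ ∈_) e∩N₁≡u (x∈p∩q⁺ (z∈e , z∈N₁)))

  E-vertex∈V : ∀ {e x y} → e ∈ₗ E H v u → Triple e u x y → x ∈ V H v u
  E-vertex∈V {e} {x} {y} e∈E t = ∈-tabulate⁺ (inV? H v u)
    (∈-tabulate⁺ (inN₂? H v) (x∉N₁ , x≢v , lose e∈B (b∈ t , u , u∈N₁ , a∈ t)) , lose e∈E (b∈ t))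
    where
    e∈B = proj₁ (E-edge e∈E)
    e∩N₁≡u = proj₂ (E-edge e∈E)
    x∉N₁ : x ∉ N₁ H v
    x∉N₁ x∈N₁ = a≢b t (sym (OnlyU⇒≡u e∩N₁≡u (b∈ t) x∈N₁))
    x≢v : x ≢ v
    x≢v refl = a≢c t (sym (OnlyU⇒≡u e∩N₁≡u (c∈ t) y∈N₁))
      where y∈N₁ = ∈-tabulate⁺ (inN₁? H v) (≢-sym (b≢c t) , lose e∈B (b∈ t , c∈ t))

  E-edge-meets-V : ∀ {e} → e ∈ₗ E H v u → 2 ≤ ∣ V H v u ∩ e ∣
  E-edge-meets-V e∈E
    with triple-through (∣edge∣≡3 (B⊆H (proj₁ (E-edge e∈E)))) (OnlyU⇒u∈ (proj₂ (E-edge e∈E)))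
  ... | x , y , t = Unique⇒length≤∣∣ ((b≢c t ∷ []) ∷ [] ∷ [])
    (x∈p∩q⁺ (E-vertex∈V e∈E t , b∈ t) ∷ x∈p∩q⁺ (E-vertex∈V e∈E (Triple-swap₂₃ t) , c∈ t) ∷ [])

  V-deg≤2 : ∀ {z} → z ∈ V H v u → deg (E H v u) z ≤ 2
  V-deg≤2 {z} z∈V =
    B-codegree≤2 u≢z (Unique.filter⁺ _ (Unique.filter⁺ _ B-unique)) (All.tabulate through-u-z)
    where
    z∉N₁ : z ∉ N₁ H v
    z∉N₁ = proj₁ (∈-tabulate⁻ (inN₂? H v) (proj₁ (∈-tabulate⁻ (inV? H v u) z∈V)))
    u≢z : u ≢ z
    u≢z refl = z∉N₁ u∈N₁
    through-u-z : ∀ {e} → e ∈ₗ filter (z ∈?_) (E H v u) → e ∈ₗ B × u ∈ e × z ∈ e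
    through-u-z e∈ with ∈-filter⁻ (z ∈?_) {xs = E H v u} e∈
    ... | e∈E , z∈e = proj₁ (E-edge e∈E) , OnlyU⇒u∈ (proj₂ (E-edge e∈E)) , z∈e

  ∣E∣≤∣V∣ : length (E H v u) ≤ ∣ V H v u ∣
  ∣E∣≤∣V∣ = *-cancelˡ-≤ 2 (double-count (V H v u) (E H v u) (All.tabulate E-edge-meets-V) V-deg≤2)

  crossEdges : List (Subset n)
  crossEdges = filter (∁? onlyU?) (filter (u ∈?_) B)

  crossEdge : ∀ {e} → e ∈ₗ crossEdges → e ∈ₗ B × u ∈ e × ¬ OnlyU e
  crossEdge e∈ with ∈-filter⁻ (∁? onlyU?) {xs = filter (u ∈?_) B} e∈
  ... | e∈uB , ¬onlyU with ∈-filter⁻ (u ∈?_) {xs = B} e∈uB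
  ...   | e∈B , u∈e = e∈B , u∈e , ¬onlyU

  deg≤∣E∣+∣crossEdges∣ : deg B u ≤ length (E H v u) + length crossEdges
  deg≤∣E∣+∣crossEdges∣ = begin
    deg B u
      ≡⟨ length-filter-partition onlyU? (filter (u ∈?_) B) ⟩
    length (filter onlyU? (filter (u ∈?_) B)) + length crossEdges
      ≤⟨ +-monoˡ-≤ (length crossEdges) (length-filter-filter onlyU? (u ∈?_) B) ⟩
    length (E H v u) + length crossEdges
      ∎

  InNeighbours : Fin n → Set
  InNeighbours w = w ∈ N₁ H v × w ≢ u × Any (λ e → u ∈ e × w ∈ e) B

  inNeighbours? : ∀ w → Dec (InNeighbours w)
  inNeighbours? w = (w ∈? N₁ H v) ×-dec ¬? (w ≟ᶠ u) ×-dec any? (λ e → (u ∈? e) ×-dec (w ∈? e)) B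

  N₁-neighbours : Subset n
  N₁-neighbours = tabulate (does ∘ inNeighbours?)

  crossEdge-meets-N₁-neighbours : ∀ {e} → e ∈ₗ crossEdges → 1 ≤ ∣ N₁-neighbours ∩ e ∣
  crossEdge-meets-N₁-neighbours e∈ with crossEdge e∈
  ... | e∈B , u∈e , ¬onlyU with anyᶠ? (λ w → (w ∈? _) ×-dec (w ∈? N₁ H v) ×-dec ¬? (w ≟ᶠ u))
  ...   | yes (w , w∈e , w∈N₁ , w≢u) = Unique⇒length≤∣∣ ([] ∷ [])
          (x∈p∩q⁺ (∈-tabulate⁺ inNeighbours? (w∈N₁ , w≢u , lose e∈B (u∈e , w∈e)) , w∈e) ∷ [])
  ...   | no none = ⊥-elim (¬onlyU (⊆-antisym ⊆u u⊆))
    where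
    ⊆u : _ ∩ N₁ H v ⊆ ⁅ u ⁆
    ⊆u {z} z∈ with z ≟ᶠ u | x∈p∩q⁻ _ (N₁ H v) z∈
    ... | yes refl | _           = x∈⁅x⁆ u
    ... | no z≢u   | z∈e , z∈N₁ = ⊥-elim (none (z , z∈e , z∈N₁ , z≢u))
    u⊆ : ⁅ u ⁆ ⊆ _ ∩ N₁ H v
    u⊆ z∈u rewrite x∈⁅y⁆⇒x≡y u z∈u = x∈p∩q⁺ (u∈e , u∈N₁)

  N₁-neighbour-deg≤2 : ∀ {w} → w ∈ N₁-neighbours → deg crossEdges w ≤ 2
  N₁-neighbour-deg≤2 {w} w∈ =
    B-codegree≤2 (≢-sym w≢u) (Unique.filter⁺ _ (Unique.filter⁺ _ (Unique.filter⁺ _ B-unique)))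
                 (All.tabulate through-u-w)
    where
    w≢u = proj₁ (proj₂ (∈-tabulate⁻ inNeighbours? w∈))
    through-u-w : ∀ {e} → e ∈ₗ filter (w ∈?_) crossEdges → e ∈ₗ B × u ∈ e × w ∈ e
    through-u-w e∈ with ∈-filter⁻ (w ∈?_) {xs = crossEdges} e∈
    ... | e∈cross , w∈e = proj₁ (crossEdge e∈cross) , proj₁ (proj₂ (crossEdge e∈cross)) , w∈e

  ∣crossEdges∣≤2∣N₁-neighbours∣ : length crossEdges ≤ 2 * ∣ N₁-neighbours ∣
  ∣crossEdges∣≤2∣N₁-neighbours∣ = subst (_≤ 2 * ∣ N₁-neighbours ∣) (*-identityˡ (length crossEdges))
    (double-count N₁-neighbours crossEdges
                  (All.tabulate crossEdge-meets-N₁-neighbours) N₁-neighbour-deg≤2)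

  InUVEdge : Fin n → Set
  InUVEdge w = Any (λ e → u ∈ e × v ∈ e × w ∈ e) B

  inUVEdge? : ∀ w → Dec (InUVEdge w)
  inUVEdge? w = any? (λ e → (u ∈? e) ×-dec (v ∈? e) ×-dec (w ∈? e)) B

  UV-edge : ∀ {w} → InNeighbours w → InUVEdge w → ∃ λ e → e ∈ₗ B × Triple e u v w
  UV-edge (w∈N₁ , w≢u , _) w∈uv with find w∈uv
  ... | e , e∈B , u∈e , v∈e , w∈e = e , e∈B ,
    mkTriple (∣edge∣≡3 (B⊆H e∈B)) u∈e v∈e w∈e u≢v (≢-sym w≢u) (≢-sym (N₁⇒≢v w∈N₁))

  bridge : ∀ {w} → InNeighbours w → ¬ InUVEdge w → Bridge u v w
  bridge {w} (w∈N₁ , w≢u , via-u) ¬inUVEdge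
    with find via-u | find (proj₂ (∈-tabulate⁻ (inN₁? H v) w∈N₁))
  ... | a , a∈B , u∈a , w∈a | b , b∈B , v∈b , w∈b
    with complete-triple (∣edge∣≡3 (B⊆H a∈B)) u∈a w∈a (≢-sym w≢u)
       | complete-triple (∣edge∣≡3 (B⊆H b∈B)) v∈b w∈b (≢-sym (N₁⇒≢v w∈N₁))
  ...   | z , ta | r , tb =
    (z , edgeOn (B⊆H a∈B) ta , λ { refl → ¬inUVEdge (lose a∈B (u∈a , c∈ ta , w∈a)) }) ,
    (r , edgeOn (B⊆H b∈B) tb , λ { refl → ¬inUVEdge (lose b∈B (c∈ tb , v∈b , w∈b)) })

  ∣N₁-neighbours∣≤7 : ∣ N₁-neighbours ∣ ≤ 7
  ∣N₁-neighbours∣≤7 = begin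
    ∣ N₁-neighbours ∣                                                 ≡⟨ sym (length-members N₁-neighbours) ⟩
    length ws                                                         ≡⟨ length-filter-partition inUVEdge? ws ⟩
    length (filter inUVEdge? ws) + length (filter (∁? inUVEdge?) ws)  ≤⟨ +-mono-≤ ∣inUVEdge∣≤2 ∣bridges∣≤5 ⟩
    7                                                                 ∎
    where
    ws = members N₁-neighbours
    ws! = members-unique N₁-neighbours
    ws⊆ : All InNeighbours ws
    ws⊆ = All.map (∈-tabulate⁻ inNeighbours?) (members-⊆ N₁-neighbours)
    ∣inUVEdge∣≤2 = B-common-neighbours≤2 (Unique.filter⁺ inUVEdge? ws!)
      (All.zipWith (λ (w∈ , w∈uv) → UV-edge w∈ w∈uv)
                   (All.filter⁺ inUVEdge? ws⊆ , All.all-filter inUVEdge? ws))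
    ∣bridges∣≤5 = bridges≤5 u≢v (Unique.filter⁺ (∁? inUVEdge?) ws!)
      (All.zipWith (λ (w∈ , w∉uv) → bridge w∈ w∉uv)
                   (All.filter⁺ (∁? inUVEdge?) ws⊆ , All.all-filter (∁? inUVEdge?) ws))

  ∣crossEdges∣≤14 : length crossEdges ≤ 14
  ∣crossEdges∣≤14 = ≤-trans ∣crossEdges∣≤2∣N₁-neighbours∣ (*-monoʳ-≤ 2 ∣N₁-neighbours∣≤7)

corollary6p3 : (n : ℕ) (H : Hypergraph3 n) → ¬ ContainsC4Trace H →
    (v : Fin n) → (u : Fin n) → u ∈ N₁ H v →
    deg (Bedges H) u ∸ 16 ≤ ∣ V H v u ∣
corollary6p3 n H noC4 v u u∈N₁ = m≤n+o⇒m∸n≤o (deg (Bedges H) u) 16 (begin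
  deg (Bedges H) u                       ≤⟨ deg≤∣E∣+∣crossEdges∣ ⟩
  length (E H v u) + length crossEdges   ≤⟨ +-mono-≤ ∣E∣≤∣V∣ (≤-trans ∣crossEdges∣≤14 (m≤m+n 14 2)) ⟩
  ∣ V H v u ∣ + 16                       ≡⟨ +-comm ∣ V H v u ∣ 16 ⟩
  16 + ∣ V H v u ∣                       ∎)
  where
  open Neighbourhood H noC4 v u u∈N₁
  open ≤-Reasoning
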